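{- Let $C^1$ and $C^2$ be cycles of orders $m\geq 3$ and $n\geq 3$, respectively. Then $\operatorname{dem}(C^1\Box C^2)=\max\{2m,2n\}$.
   Context: For a graph $X$, a set $M\subseteq V(X)$ and an edge $e\in E(X)$, $P_X(M,e)$ is the set of pairs $(x,y)$ with $x\in M$, $y\in V(X)$ such that $d_X(x,y)\neq d_{X-e}(x,y)$. An edge $e$ is monitored by $x$ if $P_X(\{x\},e)\ne\emptyset$. A distance-edge-monitoring set is a set $M$ such that every edge is monitored by some vertex of $M$; $\operatorname{dem}(X)$ is the minimum size of such a set. $\Box$ denotes the Cartesian product of graphs. -}

module Defs where

open import Data.Nat using (ℕ; zero; suc; _≤_; _∸_)
open import Data.Fin using (Fin; toℕ)
open import Data.Product using (Σ; _×_; _,_; ∃)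
open import Data.Sum using (_⊎_)
open import Data.List using (List; length)
open import Data.List.Membership.Propositional using (_∈_)
open import Data.List.Relation.Unary.Unique.Propositional using (Unique)
open import Function.Bundles using (_⇔_)
open import Relation.Nullary using (¬_)
open import Relation.Binary.PropositionalEquality using (_≡_)

-- A (simple, undirected) graph is given by its vertex type and a symmetric
-- adjacency relation.  Edges are unordered pairs {u,v} with Adj u v.

data Walk {V : Set} (Adj : V → V → Set) : V → V → ℕ → Set where
  here : ∀ {x} → Walk Adj x x zero
  step : ∀ {x y z k} → Adj x y → Walk Adj y z k → Walk Adj x z (suc k)

Dist : {V : Set} → (V → V → Set) → V → V → ℕ → Set
Dist Adj x y k = Walk Adj x y k × (∀ j → Walk Adj x y j → k ≤ j)

-- d_X(x,y) = d_Y(x,y), as extended naturals (both may be infinite, i.e.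
-- no k satisfies Dist).  Distances are unique when they exist.
SameDist : {V : Set} → (V → V → Set) → (V → V → Set) → V → V → Set
SameDist A B x y = ∀ k → Dist A x y k ⇔ Dist B x y k

DeleteEdge : {V : Set} → (V → V → Set) → V → V → (V → V → Set)
DeleteEdge Adj u v a b =
  Adj a b × ¬ ((a ≡ u × b ≡ v) ⊎ (a ≡ v × b ≡ u))

Monitors : {V : Set} → (V → V → Set) → V → V → V → Set
Monitors Adj x u v = ∃ λ y → ¬ SameDist Adj (DeleteEdge Adj u v) x y

IsDEM : {V : Set} → (V → V → Set) → List V → Set
IsDEM {V} Adj M =
  Unique M × (∀ (u v : V) → Adj u v → ∃ λ x → x ∈ M × Monitors Adj x u v)

DemIs : {V : Set} → (V → V → Set) → ℕ → Set
DemIs {V} Adj d =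
  (Σ (List V) λ M → IsDEM Adj M × length M ≡ d)
  × (∀ (M : List V) → IsDEM Adj M → d ≤ length M)

CycleAdj : (m : ℕ) → Fin m → Fin m → Set
CycleAdj m a b =
  (toℕ b ≡ suc (toℕ a)) ⊎ (toℕ a ≡ suc (toℕ b))
  ⊎ ((toℕ a ≡ 0 × toℕ b ≡ m ∸ 1) ⊎ (toℕ b ≡ 0 × toℕ a ≡ m ∸ 1))

BoxAdj : {V W : Set} → (V → V → Set) → (W → W → Set) → (V × W) → (V × W) → Set
BoxAdj A B (a , b) (c , d) = (A a c × b ≡ d) ⊎ (a ≡ c × B b d)

{-# OPTIONS --safe #-}
-- Distances in C_m □ C_n are sums of distances in the two cycles, and rotating both cycles moves any
-- vertex to the origin. Seen from a vertex x, a horizontal edge in another row is never monitored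
-- (some geodesic avoids it), while in the row of x every edge except the one or two farthest from x is.
-- So every row contains a monitor x of one of its edges and a second monitor for the row edge antipodal
-- to x: at least 2n vertices, and symmetrically 2m. Conversely, two vertices of a row at column distance
-- d with 2 ≤ d ≤ m - 2 (or 1 ≤ d < m for odd m) monitor the whole row, and for n ≤ m two suitably chosen
-- vertices per column give such a pair in every row and every column.
module Submission where

open import Defs
open import Data.Nat using (ℕ; zero; suc; _≤_; _<_; s≤s⁻¹; _*_; _⊔_; _+_; _∸_; _⊓_; z≤n; s≤s; _%_; _<?_; _≤?_; ⌊_/2⌋)
open import Data.Nat.Properties
open import Data.Nat.DivMod
open import Data.Fin as F using (Fin; toℕ; fromℕ<)
open import Data.Fin.Properties using (toℕ-injective; toℕ<n; toℕ-fromℕ<; injective⇒≤; *↔×) renaming (_≟_ to _≟ᶠ_)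
open import Data.Product using (Σ; ∃; _×_; _,_; proj₁; proj₂; swap)
open import Data.Sum using (_⊎_; inj₁; inj₂)
import Data.Sum as Sum
open import Data.Empty using (⊥; ⊥-elim)
open import Data.List using (List; length; map; _++_; allFin; lookup)
open import Data.List.Properties using (length-++; length-map; length-tabulate)
open import Data.List.Membership.Propositional using (_∈_)
open import Data.List.Membership.Propositional.Properties using (∈-map⁺; ∈-map⁻; ∈-++⁺ˡ; ∈-++⁺ʳ; ∈-allFin)
open import Data.List.Relation.Unary.Any using (index)
open import Data.List.Relation.Unary.Any.Properties using (lookup-index)
open import Data.List.Relation.Unary.Unique.Propositional using (Unique)
import Data.List.Relation.Unary.Unique.Propositional.Properties as Unique
open import Function.Base using (id; _∘_)
open import Function.Bundles using (mk⇔; Equivalence; Injection)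
open import Function.Properties.Inverse using (↔⇒↣)
open import Relation.Nullary
open import Relation.Nullary.Decidable using (decidable-stable)
open import Relation.Binary.PropositionalEquality

module _ {V : Set} {E : V → V → Set} where

  _++ʷ_ : ∀ {x y z j k} → Walk E x y j → Walk E y z k → Walk E x z (j + k)
  here     ++ʷ q = q
  step e p ++ʷ q = step e (p ++ʷ q)

  unsnoc : ∀ {x z k} → Walk E x z (suc k) → ∃ λ w → Walk E x w k × E w z
  unsnoc (step e here)         = _ , here , e
  unsnoc (step e (step e′ p)) with unsnoc (step e′ p)
  ... | w , q , e″ = w , step e q , e″

Walk-map : ∀ {V W : Set} {A : V → V → Set} {B : W → W → Set} (h : V → W) →
           (∀ {a b} → A a b → B (h a) (h b)) → ∀ {x y k} → Walk A x y k → Walk B (h x) (h y) k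
Walk-map h hom here       = here
Walk-map h hom (step e p) = step (hom e) (Walk-map h hom p)

Walk-undelete : ∀ {V : Set} {E : V → V → Set} {u v x y k} → Walk (DeleteEdge E u v) x y k → Walk E x y k
Walk-undelete = Walk-map id proj₁

Dist-map : ∀ {V W : Set} {A : V → V → Set} {B : W → W → Set} (h : V → W) (h⁻ : W → V) →
           (∀ x → h⁻ (h x) ≡ x) → (∀ {a b} → A a b → B (h a) (h b)) → (∀ {a b} → B a b → A (h⁻ a) (h⁻ b)) →
           ∀ {x y k} → Dist A x y k → Dist B (h x) (h y) k
Dist-map {A = A} h h⁻ h⁻∘h hom hom⁻ {x} {y} (w , shortest) =
  Walk-map h hom w ,
  λ j q → shortest j (subst₂ (λ a b → Walk A a b j) (h⁻∘h x) (h⁻∘h y) (Walk-map h⁻ hom⁻ q))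

DistLowerBound : ∀ {V : Set} → (V → V → Set) → V → (V → ℕ) → Set
DistLowerBound E x φ = ∀ {y k} → Walk E x y k → φ y ≤ k

lipschitz⇒walkBound : ∀ {V : Set} {E : V → V → Set} (φ : V → ℕ) → (∀ {a b} → E a b → φ b ≤ suc (φ a)) →
                      ∀ {x y k} → Walk E x y k → φ y ≤ φ x + k
lipschitz⇒walkBound φ lip {x} here = m≤m+n (φ x) 0
lipschitz⇒walkBound φ lip {x} {k = suc k} (step e w) = begin
  _             ≤⟨ lipschitz⇒walkBound φ lip w ⟩
  φ _ + k       ≤⟨ +-monoˡ-≤ k (lip e) ⟩
  suc (φ x) + k ≡⟨ +-suc (φ x) k ⟨
  φ x + suc k   ∎
  where open ≤-Reasoning

module _ {V : Set} {E : V → V → Set} where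

  Monitors-resp-≡ : ∀ {x x′ u u′ v v′} → x ≡ x′ → u ≡ u′ → v ≡ v′ → Monitors E x u v → Monitors E x′ u′ v′
  Monitors-resp-≡ refl refl refl mon = mon

  DeleteEdge-sym : ∀ {u v a b} → DeleteEdge E u v a b → DeleteEdge E v u a b
  DeleteEdge-sym (e , ≢uv) = e , λ { (inj₁ p) → ≢uv (inj₂ p) ; (inj₂ p) → ≢uv (inj₁ p) }

  Monitors-sym : ∀ {x u v} → Monitors E x u v → Monitors E x v u
  Monitors-sym (y , distChanges) = y , λ same → distChanges λ k → mk⇔
    (λ d → Dist-map id id (λ _ → refl) DeleteEdge-sym DeleteEdge-sym (Equivalence.to (same k) d))
    (λ d → Equivalence.from (same k) (Dist-map id id (λ _ → refl) DeleteEdge-sym DeleteEdge-sym d))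

  avoidingGeodesics⇒¬Monitors : ∀ {x u v} (φ : V → ℕ) → DistLowerBound E x φ →
    (∀ y → Walk (DeleteEdge E u v) x y (φ y)) → ¬ Monitors E x u v
  avoidingGeodesics⇒¬Monitors {x} {u} {v} φ bound geodesic (y , distChanges) = distChanges λ k → mk⇔
    (λ { (w , shortest) → subst (Dist (DeleteEdge E u v) x y)
           (≤-antisym (bound w) (shortest (φ y) (Walk-undelete (geodesic y))))
           (geodesic y , λ _ q → bound (Walk-undelete q)) })
    (λ { (w , shortest) → subst (Dist E x y)
           (≤-antisym (bound (Walk-undelete w)) (shortest (φ y) (geodesic y)))
           (Walk-undelete (geodesic y) , λ _ q → bound q) })

  -- Every shortest walk to v enters v through u, so deleting uv makes v strictly farther.
  lastStepForced⇒Monitors : ∀ {x u v k} (φ : V → ℕ) → DistLowerBound E x φ →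
    Walk E x v (suc k) → φ v ≡ suc k → (∀ w → E w v → w ≢ u → suc k ≤ φ w) → Monitors E x u v
  lastStepForced⇒Monitors {v = v} {k} φ bound w φv≡ far = v , λ same →
    let (w′ , _) = Equivalence.to (same (suc k)) (w , λ _ q → subst (_≤ _) φv≡ (bound q))
        (p , q , (e , ≢uv)) = unsnoc w′
    in <-irrefl refl (≤-trans (far p e (λ p≡u → ≢uv (inj₁ (p≡u , refl)))) (bound (Walk-undelete q)))

MonitoringSet : ∀ {V : Set} → (V → V → Set) → List V → Set
MonitoringSet E L = ∀ u v → E u v → ∃ λ x → x ∈ L × Monitors E x u v

record _≅_ {V W : Set} (A : V → V → Set) (B : W → W → Set) : Set where
  field
    to       : V → W
    from     : W → V
    from∘to  : ∀ x → from (to x) ≡ x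
    to∘from  : ∀ y → to (from y) ≡ y
    to-adj   : ∀ {a b} → A a b → B (to a) (to b)
    from-adj : ∀ {a b} → B a b → A (from a) (from b)

  to-injective : ∀ {a b} → to a ≡ to b → a ≡ b
  to-injective {a} {b} eq = trans (sym (from∘to a)) (trans (cong from eq) (from∘to b))

≅-sym : ∀ {V W : Set} {A : V → V → Set} {B : W → W → Set} → A ≅ B → B ≅ A
≅-sym I = record { to = from ; from = to ; from∘to = to∘from ; to∘from = from∘to
                 ; to-adj = from-adj ; from-adj = to-adj }
  where open _≅_ I

module _ {V W : Set} {A : V → V → Set} {B : W → W → Set} (I : A ≅ B) where
  open _≅_ I

  private
    to-deleteEdge : ∀ {u v a b} → DeleteEdge A u v a b → DeleteEdge B (to u) (to v) (to a) (to b)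
    to-deleteEdge (e , ≢uv) = to-adj e , λ
      { (inj₁ (p , q)) → ≢uv (inj₁ (to-injective p , to-injective q))
      ; (inj₂ (p , q)) → ≢uv (inj₂ (to-injective p , to-injective q)) }

    from-deleteEdge : ∀ {u v a b} → DeleteEdge B (to u) (to v) a b → DeleteEdge A u v (from a) (from b)
    from-deleteEdge (e , ≢uv) = from-adj e , λ
      { (inj₁ (p , q)) → ≢uv (inj₁ (to-from p , to-from q))
      ; (inj₂ (p , q)) → ≢uv (inj₂ (to-from p , to-from q)) }
      where
        to-from : ∀ {a b} → from a ≡ b → a ≡ to b
        to-from {a} eq = trans (sym (to∘from a)) (cong to eq)

    Dist-back : ∀ {R : V → V → Set} {R′ : W → W → Set} →
                (∀ {a b} → R′ a b → R (from a) (from b)) → (∀ {a b} → R a b → R′ (to a) (to b)) →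
                ∀ {x y k} → Dist R′ (to x) (to y) k → Dist R x y k
    Dist-back {R} hom⁻ hom {x} {y} {k} d =
      subst₂ (λ a b → Dist R a b k) (from∘to x) (from∘to y) (Dist-map from to to∘from hom⁻ hom d)

  Monitors-≅ : ∀ {x u v} → Monitors A x u v → Monitors B (to x) (to u) (to v)
  Monitors-≅ (y , distChanges) = to y , λ same → distChanges λ k → mk⇔
    (λ d → Dist-back from-deleteEdge to-deleteEdge
             (Equivalence.to (same k) (Dist-map to from from∘to to-adj from-adj d)))
    (λ d → Dist-back from-adj to-adj
             (Equivalence.from (same k) (Dist-map to from from∘to to-deleteEdge from-deleteEdge d)))

  IsDEM-≅ : ∀ {L} → IsDEM A L → IsDEM B (map to L)
  IsDEM-≅ {L} (unique , monitored) = Unique.map⁺ to-injective unique , λ u v e →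
    let x , x∈L , mon = monitored (from u) (from v) (from-adj e)
    in to x , ∈-map⁺ to x∈L , subst₂ (Monitors B (to x)) (to∘from u) (to∘from v) (Monitors-≅ mon)

Monitors-≅⁻ : ∀ {V W : Set} {A : V → V → Set} {B : W → W → Set} (I : A ≅ B) → let open _≅_ I in
              ∀ {x u v} → Monitors B (to x) (to u) (to v) → Monitors A x u v
Monitors-≅⁻ I {x} {u} {v} mon = Monitors-resp-≡ (from∘to x) (from∘to u) (from∘to v) (Monitors-≅ (≅-sym I) mon)
  where open _≅_ I

module _ {V V′ W W′ : Set} {A : V → V → Set} {A′ : V′ → V′ → Set} {B : W → W → Set} {B′ : W′ → W′ → Set} where

  □-≅ : A ≅ A′ → B ≅ B′ → BoxAdj A B ≅ BoxAdj A′ B′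
  □-≅ I J = record
    { to       = λ (a , b) → I.to a , J.to b
    ; from     = λ (a , b) → I.from a , J.from b
    ; from∘to  = λ (a , b) → cong₂ _,_ (I.from∘to a) (J.from∘to b)
    ; to∘from  = λ (a , b) → cong₂ _,_ (I.to∘from a) (J.to∘from b)
    ; to-adj   = λ { (inj₁ (e , eq)) → inj₁ (I.to-adj e , cong J.to eq)
                   ; (inj₂ (eq , e)) → inj₂ (cong I.to eq , J.to-adj e) }
    ; from-adj = λ { (inj₁ (e , eq)) → inj₁ (I.from-adj e , cong J.from eq)
                   ; (inj₂ (eq , e)) → inj₂ (cong I.from eq , J.from-adj e) }
    }
    where module I = _≅_ I
          module J = _≅_ J

□-comm : ∀ {V W : Set} {A : V → V → Set} {B : W → W → Set} → BoxAdj A B ≅ BoxAdj B A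
□-comm = record
  { to       = swap
  ; from     = swap
  ; from∘to  = λ _ → refl
  ; to∘from  = λ _ → refl
  ; to-adj   = λ { (inj₁ (e , eq)) → inj₂ (eq , e) ; (inj₂ (eq , e)) → inj₁ (e , eq) }
  ; from-adj = λ { (inj₁ (e , eq)) → inj₂ (eq , e) ; (inj₂ (eq , e)) → inj₁ (e , eq) }
  }

injection⇒≤length : ∀ {A : Set} {k} {L : List A} (f : Fin k → A) → (∀ {i j} → f i ≡ f j → i ≡ j) →
                    (∀ i → f i ∈ L) → k ≤ length L
injection⇒≤length {L = L} f f-injective f∈L = injective⇒≤ {f = λ i → index (f∈L i)} λ {i} {j} eq →
  f-injective (trans (lookup-index (f∈L i)) (trans (cong (lookup L) eq) (sym (lookup-index (f∈L j)))))

⌊n/2⌋-bounds : ∀ n → ⌊ n /2⌋ + ⌊ n /2⌋ ≤ n × n ≤ suc (⌊ n /2⌋ + ⌊ n /2⌋)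
⌊n/2⌋-bounds zero          = z≤n , z≤n
⌊n/2⌋-bounds (suc zero)    = z≤n , ≤-refl
⌊n/2⌋-bounds (suc (suc n)) with ⌊n/2⌋-bounds n
... | lower , upper = s≤s (subst (_≤ suc n) (sym (+-suc h h)) (s≤s lower))
                    , s≤s (subst (suc n ≤_) (cong suc (sym (+-suc h h))) (s≤s upper))
  where h = ⌊ n /2⌋

2+⌊n/2⌋≤n : ∀ n → 3 ≤ n → 2 + ⌊ n /2⌋ ≤ n
2+⌊n/2⌋≤n (suc (suc (suc k))) _ = s≤s (s≤s (⌊n/2⌋<n k))
2+⌊n/2⌋≤n (suc (suc zero)) (s≤s (s≤s ()))
2+⌊n/2⌋≤n (suc zero) (s≤s ())

module Cycle (m′ : ℕ) where

  m : ℕ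
  m = suc m′

  next : ℕ → ℕ
  next i = suc i % m

  next-cases : ∀ i → i < m → (next i ≡ suc i × suc i < m) ⊎ (next i ≡ 0 × i ≡ m′)
  next-cases i i<m with suc i <? m
  ... | yes 1+i<m = inj₁ (m<n⇒m%n≡m 1+i<m , 1+i<m)
  ... | no  1+i≮m = inj₂ (trans (cong (λ j → suc j % m) i≡m′) (n%n≡0 m) , i≡m′)
    where i≡m′ = ≤-antisym (≤-pred i<m) (≤-pred (≮⇒≥ 1+i≮m))

  next≡⇒ : ∀ (a b : Fin m) → next (toℕ a) ≡ toℕ b → toℕ b ≡ suc (toℕ a) ⊎ (toℕ b ≡ 0 × toℕ a ≡ m′)
  next≡⇒ a b eq with next-cases (toℕ a) (toℕ<n a)
  ... | inj₁ (eq′ , _)    = inj₁ (trans (sym eq) eq′)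
  ... | inj₂ (eq′ , a≡m′) = inj₂ (trans (sym eq) eq′ , a≡m′)

  CycleAdj⇒next : ∀ {a b : Fin m} → CycleAdj m a b → next (toℕ a) ≡ toℕ b ⊎ next (toℕ b) ≡ toℕ a
  CycleAdj⇒next {a} {b} (inj₁ eq)       = inj₁ (trans (cong (_% m) (sym eq)) (m<n⇒m%n≡m (toℕ<n b)))
  CycleAdj⇒next {a} {b} (inj₂ (inj₁ eq)) = inj₂ (trans (cong (_% m) (sym eq)) (m<n⇒m%n≡m (toℕ<n a)))
  CycleAdj⇒next (inj₂ (inj₂ (inj₁ (a≡0 , b≡m′)))) =
    inj₂ (trans (cong (λ j → suc j % m) b≡m′) (trans (n%n≡0 m) (sym a≡0)))
  CycleAdj⇒next (inj₂ (inj₂ (inj₂ (b≡0 , a≡m′)))) =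
    inj₁ (trans (cong (λ j → suc j % m) a≡m′) (trans (n%n≡0 m) (sym b≡0)))

  next⇒CycleAdj : ∀ {a b : Fin m} → next (toℕ a) ≡ toℕ b ⊎ next (toℕ b) ≡ toℕ a → CycleAdj m a b
  next⇒CycleAdj {a} {b} (inj₁ eq) with next≡⇒ a b eq
  ... | inj₁ b≡1+a          = inj₁ b≡1+a
  ... | inj₂ (b≡0 , a≡m′)   = inj₂ (inj₂ (inj₂ (b≡0 , a≡m′)))
  next⇒CycleAdj {a} {b} (inj₂ eq) with next≡⇒ b a eq
  ... | inj₁ a≡1+b          = inj₂ (inj₁ a≡1+b)
  ... | inj₂ (a≡0 , b≡m′)   = inj₂ (inj₂ (inj₁ (a≡0 , b≡m′)))

  [x%m+y]%m≡[x+y]%m : ∀ x y → (x % m + y) % m ≡ (x + y) % m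
  [x%m+y]%m≡[x+y]%m x y = begin
    (x % m + y) % m             ≡⟨ %-distribˡ-+ (x % m) y m ⟩
    (x % m % m + y % m) % m     ≡⟨ cong (λ z → (z + y % m) % m) (m%n%n≡m%n x m) ⟩
    (x % m + y % m) % m         ≡⟨ %-distribˡ-+ x y m ⟨
    (x + y) % m                 ∎
    where open ≡-Reasoning

  rotate : ℕ → Fin m → Fin m
  rotate c i = fromℕ< (m%n<n (toℕ i + c) m)

  toℕ-rotate : ∀ c i → toℕ (rotate c i) ≡ (toℕ i + c) % m
  toℕ-rotate c i = toℕ-fromℕ< (m%n<n (toℕ i + c) m)

  next-rotate : ∀ c {a b : Fin m} → next (toℕ a) ≡ toℕ b → next (toℕ (rotate c a)) ≡ toℕ (rotate c b)
  next-rotate c {a} {b} eq = begin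
    suc (toℕ (rotate c a)) % m ≡⟨ cong (λ z → suc z % m) (toℕ-rotate c a) ⟩
    suc ((toℕ a + c) % m) % m  ≡⟨ cong (_% m) (+-comm 1 ((toℕ a + c) % m)) ⟩
    ((toℕ a + c) % m + 1) % m  ≡⟨ [x%m+y]%m≡[x+y]%m (toℕ a + c) 1 ⟩
    (toℕ a + c + 1) % m        ≡⟨ cong (_% m) (+-comm (toℕ a + c) 1) ⟩
    (suc (toℕ a) + c) % m      ≡⟨ [x%m+y]%m≡[x+y]%m (suc (toℕ a)) c ⟨
    (next (toℕ a) + c) % m     ≡⟨ cong (λ z → (z + c) % m) eq ⟩
    (toℕ b + c) % m            ≡⟨ toℕ-rotate c b ⟨
    toℕ (rotate c b)           ∎
    where open ≡-Reasoning

  CycleAdj-rotate : ∀ c {a b : Fin m} → CycleAdj m a b → CycleAdj m (rotate c a) (rotate c b)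
  CycleAdj-rotate c e with CycleAdj⇒next e
  ... | inj₁ eq = next⇒CycleAdj (inj₁ (next-rotate c eq))
  ... | inj₂ eq = next⇒CycleAdj (inj₂ (next-rotate c eq))

  rotate-rotate : ∀ c d i → c + d ≡ m → rotate d (rotate c i) ≡ i
  rotate-rotate c d i c+d≡m = toℕ-injective (begin
    toℕ (rotate d (rotate c i))   ≡⟨ toℕ-rotate d (rotate c i) ⟩
    (toℕ (rotate c i) + d) % m    ≡⟨ cong (λ z → (z + d) % m) (toℕ-rotate c i) ⟩
    ((toℕ i + c) % m + d) % m     ≡⟨ [x%m+y]%m≡[x+y]%m (toℕ i + c) d ⟩
    (toℕ i + c + d) % m           ≡⟨ cong (_% m) (trans (+-assoc (toℕ i) c d) (cong (toℕ i +_) c+d≡m)) ⟩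
    (toℕ i + m) % m               ≡⟨ [m+n]%n≡m%n (toℕ i) m ⟩
    toℕ i % m                     ≡⟨ m<n⇒m%n≡m (toℕ<n i) ⟩
    toℕ i                         ∎)
    where open ≡-Reasoning

  rotation : ∀ c → c ≤ m → CycleAdj m ≅ CycleAdj m
  rotation c c≤m = record
    { to       = rotate c
    ; from     = rotate (m ∸ c)
    ; from∘to  = λ i → rotate-rotate c (m ∸ c) i (m+[n∸m]≡n c≤m)
    ; to∘from  = λ i → rotate-rotate (m ∸ c) c i (m∸n+n≡m c≤m)
    ; to-adj   = CycleAdj-rotate c
    ; from-adj = CycleAdj-rotate (m ∸ c)
    }

  rotationToZero : Fin m → CycleAdj m ≅ CycleAdj m
  rotationToZero b = rotation (m ∸ toℕ b) (m∸n≤m m (toℕ b))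

  rotationToZero-self : ∀ b → _≅_.to (rotationToZero b) b ≡ F.zero
  rotationToZero-self b = toℕ-injective (begin
    toℕ (rotate (m ∸ toℕ b) b) ≡⟨ toℕ-rotate (m ∸ toℕ b) b ⟩
    (toℕ b + (m ∸ toℕ b)) % m  ≡⟨ cong (_% m) (m+[n∸m]≡n (<⇒≤ (toℕ<n b))) ⟩
    m % m                      ≡⟨ n%n≡0 m ⟩
    0                          ∎)
    where open ≡-Reasoning

  -- (p − a) mod m, written so that no truncated subtraction occurs.
  offset : Fin m → Fin m → ℕ
  offset a p = (toℕ p + (m ∸ toℕ a)) % m

  %-of-<2m : ∀ y → y < m + m → y % m ≡ y ⊎ y % m + m ≡ y
  %-of-<2m y y<2m with y <? m
  ... | yes y<m = inj₁ (m<n⇒m%n≡m y<m)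
  ... | no  y≮m = inj₂ (begin
    y % m + m           ≡⟨ cong (λ z → z % m + m) (m∸n+n≡m m≤y) ⟨
    (y ∸ m + m) % m + m ≡⟨ cong (_+ m) ([m+n]%n≡m%n (y ∸ m) m) ⟩
    (y ∸ m) % m + m     ≡⟨ cong (_+ m) (m<n⇒m%n≡m (m<n+o⇒m∸n<o y m y<2m)) ⟩
    y ∸ m + m           ≡⟨ m∸n+n≡m m≤y ⟩
    y                   ∎)
    where
      open ≡-Reasoning
      m≤y = ≮⇒≥ y≮m

  offset-shift : ∀ (a a′ p : Fin m) d → toℕ a′ ≡ toℕ a + d →
                 offset a p ≡ offset a′ p + d ⊎ offset a p + m ≡ offset a′ p + d
  offset-shift a a′ p d a′≡a+d =
    Sum.map (trans offset-a) (trans (cong (_+ m) offset-a))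
            (%-of-<2m (offset a′ p + d) (+-mono-< (m%n<n (toℕ p + (m ∸ toℕ a′)) m) d<m))
    where
      a+d<m : toℕ a + d < m
      a+d<m = subst (_< m) a′≡a+d (toℕ<n a′)
      d<m : d < m
      d<m = ≤-<-trans (m≤n+m d (toℕ a)) a+d<m
      m∸a′+d≡m∸a : m ∸ toℕ a′ + d ≡ m ∸ toℕ a
      m∸a′+d≡m∸a = begin
        m ∸ toℕ a′ + d       ≡⟨ cong (λ z → m ∸ z + d) a′≡a+d ⟩
        m ∸ (toℕ a + d) + d  ≡⟨ cong (_+ d) (∸-+-assoc m (toℕ a) d) ⟨
        m ∸ toℕ a ∸ d + d    ≡⟨ m∸n+n≡m (m+n≤o⇒m≤o∸n d (subst (_≤ m) (+-comm (toℕ a) d) (<⇒≤ a+d<m))) ⟩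
        m ∸ toℕ a            ∎
        where open ≡-Reasoning
      offset-a : offset a p ≡ (offset a′ p + d) % m
      offset-a = begin
        (toℕ p + (m ∸ toℕ a)) % m       ≡⟨ cong (λ z → (toℕ p + z) % m) m∸a′+d≡m∸a ⟨
        (toℕ p + (m ∸ toℕ a′ + d)) % m  ≡⟨ cong (_% m) (+-assoc (toℕ p) (m ∸ toℕ a′) d) ⟨
        (toℕ p + (m ∸ toℕ a′) + d) % m  ≡⟨ [x%m+y]%m≡[x+y]%m (toℕ p + (m ∸ toℕ a′)) d ⟨
        (offset a′ p + d) % m           ∎
        where open ≡-Reasoning

  cycleDist : ℕ → ℕ
  cycleDist j = j ⊓ (m ∸ j)

  cycleDist-adj : ∀ {a b : Fin m} → CycleAdj m a b → cycleDist (toℕ b) ≤ suc (cycleDist (toℕ a))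
  cycleDist-adj {a} {b} (inj₁ eq) rewrite eq =
    ⊓-monoʳ-≤ (suc (toℕ a)) (m≤n⇒m≤1+n (∸-monoʳ-≤ m (n≤1+n (toℕ a))))
  cycleDist-adj {a} {b} (inj₂ (inj₁ eq)) rewrite eq =
    subst (λ z → toℕ b ⊓ (m ∸ toℕ b) ≤ suc (suc (toℕ b)) ⊓ z)
          (+-∸-assoc 1 (<⇒≤ (subst (_< m) eq (toℕ<n a))))
          (⊓-monoˡ-≤ (m ∸ toℕ b) (m≤n⇒m≤1+n (n≤1+n (toℕ b))))
  cycleDist-adj (inj₂ (inj₂ (inj₁ (a≡0 , b≡m′)))) rewrite a≡0 | b≡m′ =
    subst (m′ ⊓ (m ∸ m′) ≤_) (m+n∸n≡m 1 m′) (m⊓n≤n m′ (m ∸ m′))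
  cycleDist-adj (inj₂ (inj₂ (inj₂ (b≡0 , _)))) rewrite b≡0 = z≤n

  ascendingWalk : (R : Fin m → Fin m → Set) (top : ℕ) →
    (∀ p p′ → toℕ p′ ≡ suc (toℕ p) → toℕ p′ ≤ top → R p p′) →
    ∀ d (p q : Fin m) → toℕ q ≡ toℕ p + d → toℕ q ≤ top → Walk R p q d
  ascendingWalk R top step-ok zero p q q≡p+0 _ =
    subst (λ z → Walk R p z 0) (toℕ-injective (trans (sym (+-identityʳ (toℕ p))) (sym q≡p+0))) here
  ascendingWalk R top step-ok (suc d) p q q≡p+d q≤top =
    step (step-ok p p′ toℕp′ (≤-trans (≤-reflexive toℕp′) (≤-trans 1+p≤q q≤top)))
         (ascendingWalk R top step-ok d p′ q q≡p′+d q≤top)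
    where
      1+p≤q : suc (toℕ p) ≤ toℕ q
      1+p≤q = subst (suc (toℕ p) ≤_) (sym (trans q≡p+d (+-suc (toℕ p) d))) (s≤s (m≤m+n (toℕ p) d))
      p′ : Fin m
      p′ = fromℕ< (≤-trans (s≤s 1+p≤q) (toℕ<n q))
      toℕp′ : toℕ p′ ≡ suc (toℕ p)
      toℕp′ = toℕ-fromℕ< (≤-trans (s≤s 1+p≤q) (toℕ<n q))
      q≡p′+d : toℕ q ≡ toℕ p′ + d
      q≡p′+d = trans q≡p+d (trans (+-suc (toℕ p) d) (cong (_+ d) (sym toℕp′)))

  descendingWalk : (R : Fin m → Fin m → Set) (bottom : ℕ) →
    (∀ p p′ → toℕ p ≡ suc (toℕ p′) → bottom ≤ toℕ p′ → R p p′) →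
    ∀ d (p q : Fin m) → toℕ p ≡ toℕ q + d → bottom ≤ toℕ q → Walk R p q d
  descendingWalk R bottom step-ok zero p q p≡q+0 _ =
    subst (λ z → Walk R p z 0) (toℕ-injective (trans p≡q+0 (+-identityʳ (toℕ q)))) here
  descendingWalk R bottom step-ok (suc d) p q p≡q+d bottom≤q =
    step (step-ok p p′ p≡1+p′ (≤-trans bottom≤q (subst (toℕ q ≤_) (sym toℕp′) (m≤m+n (toℕ q) d))))
         (descendingWalk R bottom step-ok d p′ q toℕp′ bottom≤q)
    where
      q+d<m : toℕ q + d < m
      q+d<m = <-trans (n<1+n _) (subst (_< m) (trans p≡q+d (+-suc (toℕ q) d)) (toℕ<n p))
      p′ : Fin m
      p′ = fromℕ< q+d<m
      toℕp′ : toℕ p′ ≡ toℕ q + d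
      toℕp′ = toℕ-fromℕ< q+d<m
      p≡1+p′ : toℕ p ≡ suc (toℕ p′)
      p≡1+p′ = trans p≡q+d (trans (+-suc (toℕ q) d) (cong suc (sym toℕp′)))

  CycleAdj-irrefl : 1 ≤ m′ → ∀ {a : Fin m} → ¬ CycleAdj m a a
  CycleAdj-irrefl _ (inj₁ eq)       = 1+n≢n (sym eq)
  CycleAdj-irrefl _ (inj₂ (inj₁ eq)) = 1+n≢n (sym eq)
  CycleAdj-irrefl 1≤m′ (inj₂ (inj₂ (inj₁ (a≡0 , a≡m′)))) = <⇒≢ 1≤m′ (sym (trans (sym a≡m′) a≡0))
  CycleAdj-irrefl 1≤m′ (inj₂ (inj₂ (inj₂ (a≡0 , a≡m′)))) = <⇒≢ 1≤m′ (sym (trans (sym a≡m′) a≡0))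

  module Antipode (2≤m′ : 2 ≤ m′) where

    t : ℕ
    t = ⌊ m /2⌋

    t+t≤m : t + t ≤ m
    t+t≤m = proj₁ (⌊n/2⌋-bounds m)

    m≤1+t+t : m ≤ suc (t + t)
    m≤1+t+t = proj₂ (⌊n/2⌋-bounds m)

    1≤t : 1 ≤ t
    1≤t = ⌊n/2⌋-mono {2} (≤-trans (s≤s (s≤s z≤n)) (s≤s 2≤m′))

    1+t<m : suc t < m
    1+t<m = 2+⌊n/2⌋≤n m (s≤s 2≤m′)

    antipodeˡ antipodeʳ last : Fin m
    antipodeˡ = fromℕ< (<-trans (n<1+n t) 1+t<m)
    antipodeʳ = fromℕ< 1+t<m
    last      = fromℕ< (n<1+n m′)

    toℕ-antipodeˡ : toℕ antipodeˡ ≡ t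
    toℕ-antipodeˡ = toℕ-fromℕ< (<-trans (n<1+n t) 1+t<m)

    toℕ-antipodeʳ : toℕ antipodeʳ ≡ suc t
    toℕ-antipodeʳ = toℕ-fromℕ< 1+t<m

    toℕ-last : toℕ last ≡ m′
    toℕ-last = toℕ-fromℕ< (n<1+n m′)

    Avoiding : Fin m → Fin m → Set
    Avoiding = DeleteEdge (CycleAdj m) antipodeˡ antipodeʳ

    ascent-avoids : ∀ p p′ → toℕ p′ ≡ suc (toℕ p) → toℕ p′ ≤ t → Avoiding p p′
    ascent-avoids p p′ p′≡1+p p′≤t = inj₁ p′≡1+p , λ
      { (inj₁ (_ , p′≡ʳ)) → 1+n≰n (subst (_≤ t) (trans (cong toℕ p′≡ʳ) toℕ-antipodeʳ) p′≤t)
      ; (inj₂ (p≡ʳ , _)) → 1+n≰n (≤-trans (n≤1+n (suc t))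
          (subst (λ z → suc z ≤ t) (trans (cong toℕ p≡ʳ) toℕ-antipodeʳ) (subst (_≤ t) p′≡1+p p′≤t))) }

    descent-avoids : ∀ p p′ → toℕ p ≡ suc (toℕ p′) → suc t ≤ toℕ p′ → Avoiding p p′
    descent-avoids p p′ p≡1+p′ t<p′ = inj₂ (inj₁ p≡1+p′) , λ
      { (inj₁ (p≡ˡ , _)) → 1+n≰n (≤-trans t<p′ (≤-trans (n≤1+n (toℕ p′))
          (≤-reflexive (trans (sym p≡1+p′) (trans (cong toℕ p≡ˡ) toℕ-antipodeˡ)))))
      ; (inj₂ (_ , p′≡ˡ)) → 1+n≰n (subst (suc t ≤_) (trans (cong toℕ p′≡ˡ) toℕ-antipodeˡ) t<p′) }

    wrap-avoids : Avoiding F.zero last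
    wrap-avoids = inj₂ (inj₂ (inj₁ (refl , toℕ-last))) , λ
      { (inj₁ (0≡ˡ , _)) → <⇒≢ 1≤t (sym (trans (sym toℕ-antipodeˡ) (cong toℕ (sym 0≡ˡ))))
      ; (inj₂ (0≡ʳ , _)) → 0≢1+n (trans (cong toℕ 0≡ʳ) toℕ-antipodeʳ) }

    geodesicAvoiding : ∀ (j : Fin m) → Walk Avoiding F.zero j (cycleDist (toℕ j))
    geodesicAvoiding j with toℕ j ≤? t
    ... | yes j≤t = subst (Walk Avoiding F.zero j) (sym dist≡j)
                      (ascendingWalk Avoiding t ascent-avoids (toℕ j) F.zero j refl j≤t)
      where
        dist≡j : cycleDist (toℕ j) ≡ toℕ j
        dist≡j = m≤n⇒m⊓n≡m (m+n≤o⇒m≤o∸n (toℕ j) (≤-trans (+-mono-≤ j≤t j≤t) t+t≤m))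
    ... | no j≰t = subst (Walk Avoiding F.zero j) (sym dist≡1+m′∸j)
                     (step wrap-avoids (descendingWalk Avoiding (suc t) descent-avoids (m′ ∸ toℕ j) last j
                        (trans toℕ-last (sym (m+[n∸m]≡n j≤m′))) t<j))
      where
        t<j : suc t ≤ toℕ j
        t<j = ≰⇒> j≰t
        j≤m′ : toℕ j ≤ m′
        j≤m′ = ≤-pred (toℕ<n j)
        m≤j+j : m ≤ toℕ j + toℕ j
        m≤j+j = ≤-trans m≤1+t+t (+-mono-≤ t<j (≤-trans (n≤1+n t) t<j))
        dist≡1+m′∸j : cycleDist (toℕ j) ≡ suc (m′ ∸ toℕ j)
        dist≡1+m′∸j = trans (m≥n⇒m⊓n≡n (m≤n+o⇒m∸n≤o m (toℕ j) m≤j+j)) (+-∸-assoc 1 j≤m′)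

    geodesic : ∀ (j : Fin m) → Walk (CycleAdj m) F.zero j (cycleDist (toℕ j))
    geodesic j = Walk-undelete (geodesicAvoiding j)

-- The edge {q, q + 1} of C_m, seen from 0: it is monitored unless it is one of the farthest edges.
MonitoredOffset : ℕ → ℕ → Set
MonitoredOffset m q = suc q + suc q < m ⊎ m < q + q

UnmonitoredOffset : ℕ → ℕ → Set
UnmonitoredOffset m q = q + q ≤ m × m ≤ suc q + suc q

offset-dichotomy : ∀ m q → MonitoredOffset m q ⊎ UnmonitoredOffset m q
offset-dichotomy m q with suc q + suc q <? m | m <? q + q
... | yes short | _        = inj₁ (inj₁ short)
... | no _      | yes long = inj₁ (inj₂ long)
... | no ¬short | no ¬long = inj₂ (≮⇒≥ ¬long , ≮⇒≥ ¬short)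

m+m≤1+n+n⇒m≤n : ∀ {m n} → m + m ≤ suc (n + n) → m ≤ n
m+m≤1+n+n⇒m≤n {zero}          _  = z≤n
m+m≤1+n+n⇒m≤n {suc m} {zero}  (s≤s le) = contradiction (subst (_≤ 0) (+-suc m m) le) λ ()
m+m≤1+n+n⇒m≤n {suc m} {suc n} (s≤s le) =
  s≤s (m+m≤1+n+n⇒m≤n (s≤s⁻¹ (subst₂ _≤_ (+-suc m m) (cong suc (+-suc n n)) le)))

unmonitored-close : ∀ {m q₁ q₂} → UnmonitoredOffset m q₁ → UnmonitoredOffset m q₂ → q₁ ≤ suc q₂
unmonitored-close (q₁+q₁≤m , _) (_ , m≤2+q₂+q₂) =
  m+m≤1+n+n⇒m≤n (≤-trans q₁+q₁≤m (≤-trans m≤2+q₂+q₂ (n≤1+n _)))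

unmonitored-odd : ∀ {m q k} → m ≡ suc (k + k) → UnmonitoredOffset m q → q ≡ k
unmonitored-odd {q = q} {k} refl (q+q≤m , m≤2+q+q) =
  ≤-antisym (m+m≤1+n+n⇒m≤n q+q≤m) (m+m≤1+n+n⇒m≤n (s≤s⁻¹ (subst (suc (k + k) ≤_) (+-suc (suc q) q) m≤2+q+q)))

Odd : ℕ → Set
Odd m = ∃ λ k → m ≡ suc (k + k)

CoveringGap : ℕ → ℕ → Set
CoveringGap m d = (2 ≤ d × 2 + d ≤ m) ⊎ (Odd m × 1 ≤ d × d < m)

gap-2 : ∀ k → 3 ≤ k → CoveringGap k 2
gap-2 (suc zero)                (s≤s ())
gap-2 (suc (suc zero))          (s≤s (s≤s ()))
gap-2 (suc (suc (suc zero)))    _ = inj₂ ((1 , refl) , s≤s z≤n , ≤-refl)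
gap-2 (suc (suc (suc (suc k)))) _ = inj₁ (≤-refl , s≤s (s≤s (s≤s (s≤s z≤n))))

gap-k∸2 : ∀ k → 3 ≤ k → CoveringGap k (k ∸ 2)
gap-k∸2 (suc zero)                (s≤s ())
gap-k∸2 (suc (suc zero))          (s≤s (s≤s ()))
gap-k∸2 (suc (suc (suc zero)))    _ = inj₂ ((1 , refl) , ≤-refl , s≤s (s≤s z≤n))
gap-k∸2 (suc (suc (suc (suc k)))) _ = inj₁ (s≤s (s≤s z≤n) , ≤-refl)

-- Unmonitored offsets form an interval of length at most one (a single point when m is odd),
-- which two offsets a covering gap apart cannot both hit.
gap-covers : ∀ m q₁ q₂ d → CoveringGap m d → (q₁ ≡ q₂ + d ⊎ q₁ + m ≡ q₂ + d) →
             MonitoredOffset m q₁ ⊎ MonitoredOffset m q₂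
gap-covers m q₁ q₂ d gap shift with offset-dichotomy m q₁ | offset-dichotomy m q₂
... | inj₁ good₁ | _          = inj₁ good₁
... | inj₂ _     | inj₁ good₂ = inj₂ good₂
... | inj₂ bad₁  | inj₂ bad₂  = ⊥-elim (both-bad gap shift)
  where
    both-bad : CoveringGap m d → (q₁ ≡ q₂ + d ⊎ q₁ + m ≡ q₂ + d) → ⊥
    both-bad (inj₁ (2≤d , _)) (inj₁ refl) = contradiction (+-cancelˡ-≤ q₂ 2 1 (begin
      q₂ + 2 ≤⟨ +-monoʳ-≤ q₂ 2≤d ⟩
      q₂ + d ≤⟨ unmonitored-close bad₁ bad₂ ⟩
      suc q₂ ≡⟨ +-comm 1 q₂ ⟩
      q₂ + 1 ∎)) λ { (s≤s ()) }
      where open ≤-Reasoning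
    both-bad (inj₂ ((k , odd) , 1≤d , _)) (inj₁ q₁≡q₂+d) = <⇒≢ 1≤d (sym (+-cancelˡ-≡ q₂ d 0 (begin
      q₂ + d ≡⟨ q₁≡q₂+d ⟨
      q₁     ≡⟨ unmonitored-odd odd bad₁ ⟩
      k      ≡⟨ unmonitored-odd odd bad₂ ⟨
      q₂     ≡⟨ +-identityʳ q₂ ⟨
      q₂ + 0 ∎)))
      where open ≡-Reasoning
    both-bad (inj₁ (_ , 2+d≤m)) (inj₂ q₁+m≡q₂+d) = contradiction (≤-trans 2+d≤m m≤1+d) 1+n≰n
      where
        open ≤-Reasoning
        m≤1+d : m ≤ suc d
        m≤1+d = +-cancelˡ-≤ q₁ m (suc d) (begin
          q₁ + m     ≡⟨ q₁+m≡q₂+d ⟩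
          q₂ + d     ≤⟨ +-monoˡ-≤ d (unmonitored-close bad₂ bad₁) ⟩
          suc q₁ + d ≡⟨ +-suc q₁ d ⟨
          q₁ + suc d ∎)
    both-bad (inj₂ ((k , odd) , _ , d<m)) (inj₂ q₁+m≡q₂+d) = <⇒≢ d<m (sym (+-cancelˡ-≡ q₁ m d (begin
      q₁ + m ≡⟨ q₁+m≡q₂+d ⟩
      q₂ + d ≡⟨ cong (_+ d) (unmonitored-odd {k = k} odd bad₂) ⟩
      k + d  ≡⟨ cong (_+ d) (unmonitored-odd odd bad₁) ⟨
      q₁ + d ∎)))
      where open ≡-Reasoning

module Torus (m′ n′ : ℕ) (2≤m′ : 2 ≤ m′) (2≤n′ : 2 ≤ n′) where
  module Cₘ = Cycle m′
  module Cₙ = Cycle n′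
  module Aₘ = Cₘ.Antipode 2≤m′
  module Aₙ = Cₙ.Antipode 2≤n′
  open Cₘ public using (m; next; cycleDist)
  open Cₙ public using () renaming (m to n)

  V : Set
  V = Fin m × Fin n

  G : V → V → Set
  G = BoxAdj (CycleAdj m) (CycleAdj n)

  row : V → Fin n
  row = proj₂

  origin : V
  origin = F.zero , F.zero

  torusDist : V → ℕ
  torusDist (a , b) = cycleDist (toℕ a) + Cₙ.cycleDist (toℕ b)

  torusDist-adj : ∀ {a b} → G a b → torusDist b ≤ suc (torusDist a)
  torusDist-adj {a₁ , a₂} {b₁ , _} (inj₁ (e , refl)) = +-monoˡ-≤ (Cₙ.cycleDist (toℕ a₂)) (Cₘ.cycleDist-adj e)
  torusDist-adj {a₁ , a₂} {_ , b₂} (inj₂ (refl , e)) =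
    ≤-trans (+-monoʳ-≤ (cycleDist (toℕ a₁)) (Cₙ.cycleDist-adj e)) (≤-reflexive (+-suc _ _))

  torusDist-lowerBound : DistLowerBound G origin torusDist
  torusDist-lowerBound = lipschitz⇒walkBound torusDist torusDist-adj

  private
    1≤n′ : 1 ≤ n′
    1≤n′ = ≤-trans (s≤s z≤n) 2≤n′

  verticalStep-avoids : ∀ {u v a b b′} → row u ≡ row v → CycleAdj n b b′ → DeleteEdge G u v (a , b) (a , b′)
  verticalStep-avoids {b = b} u∼v e = inj₂ (refl , e) , λ
    { (inj₁ (eq , eq′)) → Cₙ.CycleAdj-irrefl 1≤n′
        (subst (CycleAdj n b) (trans (cong row eq′) (trans (sym u∼v) (sym (cong row eq)))) e)
    ; (inj₂ (eq , eq′)) → Cₙ.CycleAdj-irrefl 1≤n′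
        (subst (CycleAdj n b) (trans (cong row eq′) (trans u∼v (sym (cong row eq)))) e) }

  ¬Monitors-origin-offRow : ∀ {u v} → row u ≡ row v → row u ≢ F.zero → ¬ Monitors G origin u v
  ¬Monitors-origin-offRow {u} {v} u∼v u≢0 =
    avoidingGeodesics⇒¬Monitors torusDist torusDist-lowerBound λ (y₁ , y₂) →
      Walk-map (_, F.zero) alongRow0 (Aₘ.geodesic y₁) ++ʷ Walk-map (y₁ ,_) (verticalStep-avoids u∼v) (Aₙ.geodesic y₂)
    where
      alongRow0 : ∀ {a a′} → CycleAdj m a a′ → DeleteEdge G u v (a , F.zero) (a′ , F.zero)
      alongRow0 e = inj₁ (e , refl) , λ
        { (inj₁ (eq , _)) → u≢0 (sym (cong row eq))
        ; (inj₂ (eq , _)) → u≢0 (trans u∼v (sym (cong row eq))) }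

  ¬Monitors-origin-antipodal : ¬ Monitors G origin (Aₘ.antipodeˡ , F.zero) (Aₘ.antipodeʳ , F.zero)
  ¬Monitors-origin-antipodal =
    avoidingGeodesics⇒¬Monitors torusDist torusDist-lowerBound λ (y₁ , y₂) →
      subst (Walk (DeleteEdge G u v) origin (y₁ , y₂)) (+-comm (Cₙ.cycleDist (toℕ y₂)) (cycleDist (toℕ y₁)))
        (Walk-map (F.zero ,_) (verticalStep-avoids refl) (Aₙ.geodesic y₂) ++ʷ
         Walk-map (_, y₂) alongRow (Aₘ.geodesicAvoiding y₁))
    where
      u v : V
      u = Aₘ.antipodeˡ , F.zero
      v = Aₘ.antipodeʳ , F.zero
      alongRow : ∀ {b a a′} → Aₘ.Avoiding a a′ → DeleteEdge G u v (a , b) (a′ , b)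
      alongRow (e , ≢uv) = inj₁ (e , refl) , λ
        { (inj₁ (eq , eq′)) → ≢uv (inj₁ (cong proj₁ eq , cong proj₁ eq′))
        ; (inj₂ (eq , eq′)) → ≢uv (inj₂ (cong proj₁ eq , cong proj₁ eq′)) }

  neighbourInRow0-far : ∀ {U W : Fin m} {k} → cycleDist (toℕ W) ≡ k →
    (∀ {w} → CycleAdj m w W → w ≢ U → k ≤ cycleDist (toℕ w)) →
    ∀ w → G w (W , F.zero) → w ≢ (U , F.zero) → k ≤ torusDist w
  neighbourInRow0-far dist-W farInRow (w₁ , _) (inj₁ (e , refl)) w≢U =
    ≤-trans (farInRow e (λ eq → w≢U (cong (_, F.zero) eq))) (m≤m+n _ _)
  neighbourInRow0-far dist-W farInRow (_ , _) (inj₂ (refl , _)) _ = ≤-trans (≤-reflexive (sym dist-W)) (m≤m+n _ _)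

  Monitors-origin-ascending : ∀ (U W : Fin m) → toℕ W ≡ suc (toℕ U) → suc (toℕ U) + suc (toℕ U) < m →
                              Monitors G origin (U , F.zero) (W , F.zero)
  Monitors-origin-ascending U W W≡1+U short =
    lastStepForced⇒Monitors torusDist torusDist-lowerBound walk dist-W
                            (neighbourInRow0-far dist-W′ farInRow)
    where
      q = toℕ U
      walk : Walk G origin (W , F.zero) (suc q)
      walk = Walk-map (_, F.zero) (λ e → inj₁ (e , refl))
               (Cₘ.ascendingWalk (CycleAdj m) m′ (λ _ _ eq _ → inj₁ eq) (suc q) F.zero W W≡1+U (≤-pred (toℕ<n W)))
      dist-W′ : cycleDist (toℕ W) ≡ suc q
      dist-W′ = trans (cong cycleDist W≡1+U) (m≤n⇒m⊓n≡m (m+n≤o⇒m≤o∸n (suc q) (<⇒≤ short)))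
      dist-W : torusDist (W , F.zero) ≡ suc q
      dist-W = trans (+-identityʳ _) dist-W′
      farInRow : ∀ {w} → CycleAdj m w W → w ≢ U → suc q ≤ cycleDist (toℕ w)
      farInRow (inj₁ eq) w≢U = contradiction (toℕ-injective (suc-injective (trans (sym eq) W≡1+U))) w≢U
      farInRow {w} (inj₂ (inj₁ eq)) _ rewrite eq | W≡1+U =
        ⊓-glb (n≤1+n (suc q)) (m+n≤o⇒m≤o∸n (suc q) (subst (_≤ m) (sym (+-suc (suc q) (suc q))) short))
      farInRow (inj₂ (inj₂ (inj₁ (_ , W≡m′)))) _ = contradiction (≤-trans (s≤s (m≤n+m (suc q) q))
        (≤-pred (subst (λ z → suc q + suc q < suc z) (trans (sym W≡m′) W≡1+U) short))) 1+n≰n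
      farInRow (inj₂ (inj₂ (inj₂ (W≡0 , _)))) _ = contradiction (trans (sym W≡0) W≡1+U) 0≢1+n

  Monitors-origin-descending : ∀ (U W : Fin m) → next (toℕ U) ≡ toℕ W → m < toℕ U + toℕ U →
                               Monitors G origin (U , F.zero) (W , F.zero)
  Monitors-origin-descending U W next≡W long =
    Monitors-sym (lastStepForced⇒Monitors torusDist torusDist-lowerBound walk dist-U
                                          (neighbourInRow0-far dist-U′ farInRow))
    where
      q = toℕ U
      q≤m′ : q ≤ m′
      q≤m′ = ≤-pred (toℕ<n U)
      walk : Walk G origin (U , F.zero) (suc (m′ ∸ q))
      walk = Walk-map (_, F.zero) (λ e → inj₁ (e , refl))
               (step (inj₂ (inj₂ (inj₁ (refl , Aₘ.toℕ-last))))
                 (Cₘ.descendingWalk (CycleAdj m) 0 (λ _ _ eq _ → inj₂ (inj₁ eq)) (m′ ∸ q) Aₘ.last U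
                    (trans Aₘ.toℕ-last (sym (m+[n∸m]≡n q≤m′))) z≤n))
      dist-U′ : cycleDist q ≡ suc (m′ ∸ q)
      dist-U′ = trans (m≥n⇒m⊓n≡n (m≤n+o⇒m∸n≤o m q (<⇒≤ long))) (+-∸-assoc 1 q≤m′)
      dist-U : torusDist (U , F.zero) ≡ suc (m′ ∸ q)
      dist-U = trans (+-identityʳ _) dist-U′
      farInRow : ∀ {w} → CycleAdj m w U → w ≢ W → suc (m′ ∸ q) ≤ cycleDist (toℕ w)
      farInRow {w} (inj₁ U≡1+w) _ =
        subst (_≤ cycleDist x) (trans (cong (m ∸_) (sym U≡1+w)) (+-∸-assoc 1 q≤m′))
          (⊓-glb (m≤n+o⇒m∸n≤o m (suc x) (≤-pred (subst (m <_) (+-suc (suc x) x) m<2+2x)))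
                 (∸-monoʳ-≤ m (n≤1+n x)))
        where
          x = toℕ w
          m<2+2x : m < suc x + suc x
          m<2+2x = subst (λ z → m < z + z) U≡1+w long
      farInRow {w} (inj₂ (inj₁ w≡1+U)) w≢W with Cₘ.next≡⇒ U W next≡W
      ... | inj₁ W≡1+U = contradiction (toℕ-injective (trans w≡1+U (sym W≡1+U))) w≢W
      ... | inj₂ (_ , U≡m′) = contradiction (subst (_< m) (trans w≡1+U (cong suc U≡m′)) (toℕ<n w)) 1+n≰n
      farInRow {w} (inj₂ (inj₂ (inj₁ (w≡0 , U≡m′)))) w≢W with Cₘ.next≡⇒ U W next≡W
      ... | inj₁ W≡1+U = contradiction (subst (_< m) (trans W≡1+U (cong suc U≡m′)) (toℕ<n W)) 1+n≰n
      ... | inj₂ (W≡0 , _) = contradiction (toℕ-injective (trans w≡0 (sym W≡0))) w≢W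
      farInRow (inj₂ (inj₂ (inj₂ (U≡0 , _)))) _ = contradiction (subst (λ z → m < z + z) U≡0 long) λ ()

  Monitors-origin-row0 : ∀ (U W : Fin m) → next (toℕ U) ≡ toℕ W → MonitoredOffset m (toℕ U) →
                         Monitors G origin (U , F.zero) (W , F.zero)
  Monitors-origin-row0 U W next≡W (inj₂ long) = Monitors-origin-descending U W next≡W long
  Monitors-origin-row0 U W next≡W (inj₁ short) with Cₘ.next≡⇒ U W next≡W
  ... | inj₁ W≡1+U      = Monitors-origin-ascending U W W≡1+U short
  ... | inj₂ (_ , U≡m′) = contradiction (subst (λ z → suc z + suc z < m) U≡m′ short)
                            (λ lt → 1+n≰n (≤-trans lt (s≤s (m≤m+n m′ (suc m′)))))

  toOrigin : V → G ≅ G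
  toOrigin (a , b) = □-≅ (Cₘ.rotationToZero a) (Cₙ.rotationToZero b)

  toOrigin-self : ∀ x → _≅_.to (toOrigin x) x ≡ origin
  toOrigin-self (a , b) = cong₂ _,_ (Cₘ.rotationToZero-self a) (Cₙ.rotationToZero-self b)

  Monitors-inRow : ∀ x p p′ → next (toℕ p) ≡ toℕ p′ → MonitoredOffset m (Cₘ.offset (proj₁ x) p) →
                   Monitors G x (p , row x) (p′ , row x)
  Monitors-inRow x@(a , b) p p′ next≡p′ good = Monitors-≅⁻ (toOrigin x)
    (Monitors-resp-≡ (sym (toOrigin-self x)) (cong (_ ,_) b↦0) (cong (_ ,_) b↦0)
      (Monitors-origin-row0 (rotate p) (rotate p′) (Cₘ.next-rotate c next≡p′)
        (subst (MonitoredOffset m) (sym (Cₘ.toℕ-rotate c p)) good)))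
    where
      c = m ∸ toℕ a
      rotate = Cₘ.rotate c
      b↦0 = sym (Cₙ.rotationToZero-self b)

  ¬Monitors-offRow : ∀ x u v → row u ≡ row v → row u ≢ row x → ¬ Monitors G x u v
  ¬Monitors-offRow x@(_ , b) u v u∼v u≁x mon =
    ¬Monitors-origin-offRow (cong R.to u∼v)
      (λ eq → u≁x (R.to-injective (trans eq (sym (Cₙ.rotationToZero-self b)))))
      (Monitors-resp-≡ (toOrigin-self x) refl refl (Monitors-≅ (toOrigin x) mon))
    where module R = _≅_ (Cₙ.rotationToZero b)

  Monitors-inRow⇒sameRow : ∀ {x u v} → row u ≡ row v → Monitors G x u v → row x ≡ row u
  Monitors-inRow⇒sameRow {x} {u} {v} u∼v mon =
    decidable-stable (row x ≟ᶠ row u) λ x≁u → ¬Monitors-offRow x u v u∼v (x≁u ∘ sym) mon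

  opaque
    antipodalˡ antipodalʳ : V → V
    antipodalˡ x = _≅_.from (toOrigin x) (Aₘ.antipodeˡ , F.zero)
    antipodalʳ x = _≅_.from (toOrigin x) (Aₘ.antipodeʳ , F.zero)

    antipodal-adj : ∀ x → G (antipodalˡ x) (antipodalʳ x)
    antipodal-adj x = _≅_.from-adj (toOrigin x) {Aₘ.antipodeˡ , F.zero} {Aₘ.antipodeʳ , F.zero}
      (inj₁ (inj₁ (trans Aₘ.toℕ-antipodeʳ (cong suc (sym Aₘ.toℕ-antipodeˡ))) , refl))

    row-antipodal : ∀ x → row (antipodalˡ x) ≡ row x × row (antipodalʳ x) ≡ row x
    row-antipodal (_ , b) = row-back , row-back
      where
        module R = _≅_ (Cₙ.rotationToZero b)
        row-back : R.from F.zero ≡ b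
        row-back = trans (cong R.from (sym (Cₙ.rotationToZero-self b))) (R.from∘to b)

    ¬Monitors-antipodal : ∀ x → ¬ Monitors G x (antipodalˡ x) (antipodalʳ x)
    ¬Monitors-antipodal x mon = ¬Monitors-origin-antipodal
      (Monitors-resp-≡ (toOrigin-self x) (I.to∘from (Aₘ.antipodeˡ , F.zero)) (I.to∘from (Aₘ.antipodeʳ , F.zero))
        (Monitors-≅ (toOrigin x) mon))
      where module I = _≅_ (toOrigin x)

  record TwoMonitorsInRow (L : List V) (b : Fin n) : Set where
    field
      first second   : V
      first∈L        : first ∈ L
      second∈L       : second ∈ L
      row-first      : row first ≡ b
      row-second     : row second ≡ b
      first≢second   : first ≢ second

  twoMonitorsPerRow : ∀ {L} → MonitoringSet G L → ∀ b → TwoMonitorsInRow L b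
  twoMonitorsPerRow {L} mon b = record
    { first        = x
    ; second       = y
    ; first∈L      = proj₁ (proj₂ x-witness)
    ; second∈L     = proj₁ (proj₂ y-witness)
    ; row-first    = row-x
    ; row-second   = trans row-y (trans (proj₁ (row-antipodal x)) row-x)
    ; first≢second = λ x≡y → ¬Monitors-antipodal x
        (subst (λ z → Monitors G z (antipodalˡ x) (antipodalʳ x)) (sym x≡y) (proj₂ (proj₂ y-witness)))
    }
    where
      1<m : 1 < m
      1<m = s≤s (≤-trans (s≤s z≤n) 2≤m′)
      x-witness : ∃ λ x → x ∈ L × Monitors G x (F.zero , b) (fromℕ< 1<m , b)
      x-witness = mon _ _ (inj₁ (inj₁ (toℕ-fromℕ< 1<m) , refl))
      x = proj₁ x-witness
      row-x : row x ≡ b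
      row-x = Monitors-inRow⇒sameRow refl (proj₂ (proj₂ x-witness))
      y-witness : ∃ λ y → y ∈ L × Monitors G y (antipodalˡ x) (antipodalʳ x)
      y-witness = mon _ _ (antipodal-adj x)
      y = proj₁ y-witness
      row-y : row y ≡ row (antipodalˡ x)
      row-y = Monitors-inRow⇒sameRow (trans (proj₁ (row-antipodal x)) (sym (proj₂ (row-antipodal x))))
                                     (proj₂ (proj₂ y-witness))

  rowsLowerBound : ∀ {L} → MonitoringSet G L → n * 2 ≤ length L
  rowsLowerBound {L} mon =
    injection⇒≤length (pick ∘ remQuot) (λ eq → Injection.injective (↔⇒↣ *↔×) (pick-injective _ _ eq))
                      (λ i → pick∈L (remQuot i))
    where
      open TwoMonitorsInRow
      remQuot = Injection.to (↔⇒↣ (*↔× {n} {2}))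
      pick : Fin n × Fin 2 → V
      pick (b , F.zero)  = first (twoMonitorsPerRow mon b)
      pick (b , F.suc _) = second (twoMonitorsPerRow mon b)
      pick∈L : ∀ i → pick i ∈ L
      pick∈L (b , F.zero)  = first∈L (twoMonitorsPerRow mon b)
      pick∈L (b , F.suc _) = second∈L (twoMonitorsPerRow mon b)
      row-pick : ∀ i → row (pick i) ≡ proj₁ i
      row-pick (b , F.zero)  = row-first (twoMonitorsPerRow mon b)
      row-pick (b , F.suc _) = row-second (twoMonitorsPerRow mon b)
      pick-injective : ∀ i j → pick i ≡ pick j → i ≡ j
      pick-injective i j eq with trans (sym (row-pick i)) (trans (cong row eq) (row-pick j))
      pick-injective (b , F.zero)       (.b , F.zero)       eq | refl = refl
      pick-injective (b , F.zero)       (.b , F.suc F.zero) eq | refl =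
        contradiction eq (first≢second (twoMonitorsPerRow mon b))
      pick-injective (b , F.suc F.zero) (.b , F.zero)       eq | refl =
        contradiction (sym eq) (first≢second (twoMonitorsPerRow mon b))
      pick-injective (b , F.suc F.zero) (.b , F.suc F.zero) eq | refl = refl

  module _ (b : Fin n) (c₁ c₂ : Fin m) (d : ℕ) (c₂≡c₁+d : toℕ c₂ ≡ toℕ c₁ + d) (gap : CoveringGap m d) where

    coveringPair-monitorsStep : ∀ p p′ → next (toℕ p) ≡ toℕ p′ →
      Monitors G (c₁ , b) (p , b) (p′ , b) ⊎ Monitors G (c₂ , b) (p , b) (p′ , b)
    coveringPair-monitorsStep p p′ next≡p′ =
      Sum.map (Monitors-inRow (c₁ , b) p p′ next≡p′) (Monitors-inRow (c₂ , b) p p′ next≡p′)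
        (gap-covers m (Cₘ.offset c₁ p) (Cₘ.offset c₂ p) d gap (Cₘ.offset-shift c₁ c₂ p d c₂≡c₁+d))

    coveringPair-monitorsRow : ∀ p p′ → CycleAdj m p p′ →
      Monitors G (c₁ , b) (p , b) (p′ , b) ⊎ Monitors G (c₂ , b) (p , b) (p′ , b)
    coveringPair-monitorsRow p p′ e with Cₘ.CycleAdj⇒next e
    ... | inj₁ next≡p′ = coveringPair-monitorsStep p p′ next≡p′
    ... | inj₂ next≡p  = Sum.map Monitors-sym Monitors-sym (coveringPair-monitorsStep p′ p next≡p)

  CoveringPairInRow : List V → Fin n → Set
  CoveringPairInRow L b = Σ (Fin m × Fin m × ℕ) λ (c₁ , c₂ , d) →
    ((c₁ , b) ∈ L × (c₂ , b) ∈ L) × toℕ c₂ ≡ toℕ c₁ + d × CoveringGap m d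

  coveringPairs⇒monitorsRows : ∀ {L} → (∀ b → CoveringPairInRow L b) →
    ∀ p p′ b → CycleAdj m p p′ → ∃ λ x → x ∈ L × Monitors G x (p , b) (p′ , b)
  coveringPairs⇒monitorsRows pairs p p′ b e with pairs b
  ... | (c₁ , c₂ , d) , (c₁∈L , c₂∈L) , c₂≡c₁+d , gap with coveringPair-monitorsRow b c₁ c₂ d c₂≡c₁+d gap p p′ e
  ...   | inj₁ mon = (c₁ , b) , c₁∈L , mon
  ...   | inj₂ mon = (c₂ , b) , c₂∈L , mon

module UpperBound (m′ n′ : ℕ) (2≤m′ : 2 ≤ m′) (2≤n′ : 2 ≤ n′) (n′≤m′ : n′ ≤ m′) where
  open Torus m′ n′ 2≤m′ 2≤n′
  module Tˢ = Torus n′ m′ 2≤n′ 2≤m′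

  n≤m : n ≤ m
  n≤m = s≤s n′≤m′

  2≤n : 2 ≤ n
  2≤n = ≤-trans (s≤s (s≤s z≤n)) (s≤s 2≤n′)

  -- Column c carries the rows r and r + 2 (mod n), where r = c for c < n and r = c + 1 (mod n)
  -- otherwise; without that shift row 1 of C₄ □ C₃ would contain no covering pair.
  wrapBump : ℕ → ℕ
  wrapBump i with i <? n
  ... | yes _ = 0
  ... | no  _ = 1

  row₁ row₂ : ℕ → ℕ
  row₁ i = (i + wrapBump i) % n
  row₂ i = (row₁ i + 2) % n

  row₁-small : ∀ i → i < n → row₁ i ≡ i
  row₁-small i i<n with i <? n
  ... | yes _   = trans (cong (_% n) (+-identityʳ i)) (m<n⇒m%n≡m i<n)
  ... | no  i≮n = contradiction i<n i≮n

  row₁-large : ∀ i → ¬ i < n → row₁ i ≡ suc i % n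
  row₁-large i i≮n with i <? n
  ... | yes i<n = contradiction i<n i≮n
  ... | no  _   = cong (_% n) (+-comm i 1)

  firstRow secondRow : Fin m → Fin n
  firstRow  c = fromℕ< (m%n<n (toℕ c + wrapBump (toℕ c)) n)
  secondRow c = fromℕ< (m%n<n (row₁ (toℕ c) + 2) n)

  toℕ-firstRow : ∀ c → toℕ (firstRow c) ≡ row₁ (toℕ c)
  toℕ-firstRow c = toℕ-fromℕ< (m%n<n (toℕ c + wrapBump (toℕ c)) n)

  toℕ-secondRow : ∀ c → toℕ (secondRow c) ≡ row₂ (toℕ c)
  toℕ-secondRow c = toℕ-fromℕ< (m%n<n (row₁ (toℕ c) + 2) n)

  L₁ L₂ L : List V
  L₁ = map (λ c → c , firstRow c) (allFin m)
  L₂ = map (λ c → c , secondRow c) (allFin m)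
  L  = L₁ ++ L₂

  ∈L₁ : ∀ c b → toℕ b ≡ row₁ (toℕ c) → (c , b) ∈ L
  ∈L₁ c b b≡ = ∈-++⁺ˡ (subst (_∈ L₁) (cong (c ,_) (toℕ-injective (trans (toℕ-firstRow c) (sym b≡))))
                                   (∈-map⁺ (λ c → c , firstRow c) (∈-allFin c)))

  ∈L₂ : ∀ c b → toℕ b ≡ row₂ (toℕ c) → (c , b) ∈ L
  ∈L₂ c b b≡ = ∈-++⁺ʳ L₁ (subst (_∈ L₂) (cong (c ,_) (toℕ-injective (trans (toℕ-secondRow c) (sym b≡))))
                                      (∈-map⁺ (λ c → c , secondRow c) (∈-allFin c)))

  length-L : length L ≡ m + m
  length-L = trans (length-++ L₁) (cong₂ _+_ (length-allFin-map _) (length-allFin-map _))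
    where
      length-allFin-map : ∀ {A : Set} (f : Fin m → A) → length (map f (allFin m)) ≡ m
      length-allFin-map f = trans (length-map f (allFin m)) (length-tabulate id)

  row₁+2<2n : ∀ i → row₁ i + 2 < n + n
  row₁+2<2n i = +-mono-< (m%n<n (i + wrapBump i) n) (s≤s 2≤n′)

  row₁≢row₂ : ∀ i → row₁ i ≢ row₂ i
  row₁≢row₂ i eq with Cₙ.%-of-<2m (row₁ i + 2) (row₁+2<2n i)
  ... | inj₁ no-wrap = m+1+n≢m (row₁ i) (sym (trans eq no-wrap))
  ... | inj₂ wrap    = <⇒≢ (s≤s 2≤n′) (sym (+-cancelˡ-≡ (row₁ i) n 2 (trans (cong (_+ n) eq) wrap)))

  firstRow≢secondRow : ∀ c → firstRow c ≢ secondRow c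
  firstRow≢secondRow c eq =
    row₁≢row₂ (toℕ c) (trans (sym (toℕ-firstRow c)) (trans (cong toℕ eq) (toℕ-secondRow c)))

  unique-L : Unique L
  unique-L = Unique.++⁺ (Unique.map⁺ (cong proj₁) (Unique.allFin⁺ m))
                        (Unique.map⁺ (cong proj₁) (Unique.allFin⁺ m)) disjoint
    where
      disjoint : ∀ {v} → ¬ (v ∈ L₁ × v ∈ L₂)
      disjoint (v∈L₁ , v∈L₂) with ∈-map⁻ (λ c → c , firstRow c) v∈L₁ | ∈-map⁻ (λ c → c , secondRow c) v∈L₂
      ... | c , _ , refl | c′ , _ , eq with cong proj₁ eq
      ... | refl = firstRow≢secondRow c (cong proj₂ eq)

  CoveringPairInColumn : Fin m → Set
  CoveringPairInColumn a = Σ (Fin n × Fin n × ℕ) λ (s₁ , s₂ , d) →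
    ((a , s₁) ∈ L × (a , s₂) ∈ L) × toℕ s₂ ≡ toℕ s₁ + d × CoveringGap n d

  coveringPairInColumn : ∀ a → CoveringPairInColumn a
  coveringPairInColumn a with Cₙ.%-of-<2m (row₁ (toℕ a) + 2) (row₁+2<2n (toℕ a))
  ... | inj₁ no-wrap =
    (firstRow a , secondRow a , 2) , (∈L₁ a _ (toℕ-firstRow a) , ∈L₂ a _ (toℕ-secondRow a)) ,
    trans (toℕ-secondRow a) (trans no-wrap (cong (_+ 2) (sym (toℕ-firstRow a)))) , gap-2 n (s≤s 2≤n′)
  ... | inj₂ wrap =
    (secondRow a , firstRow a , n ∸ 2) , (∈L₂ a _ (toℕ-secondRow a) , ∈L₁ a _ (toℕ-firstRow a)) ,
    +-cancelʳ-≡ 2 _ _ (begin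
      toℕ (firstRow a) + 2            ≡⟨ cong (_+ 2) (toℕ-firstRow a) ⟩
      row₁ (toℕ a) + 2                ≡⟨ wrap ⟨
      row₂ (toℕ a) + n                ≡⟨ cong (_+ n) (toℕ-secondRow a) ⟨
      toℕ (secondRow a) + n           ≡⟨ cong (toℕ (secondRow a) +_) (m∸n+n≡m 2≤n) ⟨
      toℕ (secondRow a) + (n ∸ 2 + 2) ≡⟨ +-assoc (toℕ (secondRow a)) (n ∸ 2) 2 ⟨
      toℕ (secondRow a) + (n ∸ 2) + 2 ∎) ,
    gap-k∸2 n (s≤s 2≤n′)
    where open ≡-Reasoning

  coveringPairInHighRow : ∀ b j → toℕ b ≡ 2 + j → CoveringPairInRow L b
  coveringPairInHighRow b j b≡2+j = (c₁ , c₂ , 2) , (c₁∈L , c₂∈L) , c₂≡c₁+2 , gap-2 m (s≤s 2≤m′)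
    where
      2+j<n : 2 + j < n
      2+j<n = subst (_< n) b≡2+j (toℕ<n b)
      j<n : j < n
      j<n = ≤-<-trans (m≤n+m j 2) 2+j<n
      c₁ c₂ : Fin m
      c₁ = fromℕ< (<-≤-trans j<n n≤m)
      c₂ = fromℕ< (<-≤-trans 2+j<n n≤m)
      toℕ-c₁ : toℕ c₁ ≡ j
      toℕ-c₁ = toℕ-fromℕ< (<-≤-trans j<n n≤m)
      toℕ-c₂ : toℕ c₂ ≡ 2 + j
      toℕ-c₂ = toℕ-fromℕ< (<-≤-trans 2+j<n n≤m)
      c₁∈L : (c₁ , b) ∈ L
      c₁∈L = ∈L₂ c₁ b (begin
        toℕ b               ≡⟨ b≡2+j ⟩
        2 + j               ≡⟨ m<n⇒m%n≡m 2+j<n ⟨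
        (2 + j) % n         ≡⟨ cong (_% n) (+-comm 2 j) ⟩
        (j + 2) % n         ≡⟨ cong (λ r → (r + 2) % n) (row₁-small j j<n) ⟨
        row₂ j              ≡⟨ cong row₂ toℕ-c₁ ⟨
        row₂ (toℕ c₁)       ∎)
        where open ≡-Reasoning
      c₂∈L : (c₂ , b) ∈ L
      c₂∈L = ∈L₁ c₂ b (trans b≡2+j (sym (trans (cong row₁ toℕ-c₂) (row₁-small (2 + j) 2+j<n))))
      c₂≡c₁+2 : toℕ c₂ ≡ toℕ c₁ + 2
      c₂≡c₁+2 = trans toℕ-c₂ (trans (+-comm 2 j) (cong (_+ 2) (sym toℕ-c₁)))

  coveringPairInLowRow-4≤n : ∀ b j → toℕ b ≡ j → j < 2 → 3 ≤ n′ → CoveringPairInRow L b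
  coveringPairInLowRow-4≤n b j b≡j j<2 3≤n′ = (c₁ , c₂ , n ∸ 2) , (c₁∈L , c₂∈L) , c₂≡c₁+d , gap
    where
      j<n : j < n
      j<n = subst (_< n) b≡j (toℕ<n b)
      j+d<n : j + (n ∸ 2) < n
      j+d<n = subst (j + (n ∸ 2) <_) (m+[n∸m]≡n 2≤n) (+-monoˡ-< (n ∸ 2) j<2)
      c₁ c₂ : Fin m
      c₁ = fromℕ< (<-≤-trans j<n n≤m)
      c₂ = fromℕ< (<-≤-trans j+d<n n≤m)
      toℕ-c₁ : toℕ c₁ ≡ j
      toℕ-c₁ = toℕ-fromℕ< (<-≤-trans j<n n≤m)
      toℕ-c₂ : toℕ c₂ ≡ j + (n ∸ 2)
      toℕ-c₂ = toℕ-fromℕ< (<-≤-trans j+d<n n≤m)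
      c₁∈L : (c₁ , b) ∈ L
      c₁∈L = ∈L₁ c₁ b (trans b≡j (sym (trans (cong row₁ toℕ-c₁) (row₁-small j j<n))))
      c₂∈L : (c₂ , b) ∈ L
      c₂∈L = ∈L₂ c₂ b (begin
        toℕ b                        ≡⟨ b≡j ⟩
        j                            ≡⟨ m<n⇒m%n≡m j<n ⟨
        j % n                        ≡⟨ [m+n]%n≡m%n j n ⟨
        (j + n) % n                  ≡⟨ cong (λ z → (j + z) % n) (m∸n+n≡m 2≤n) ⟨
        (j + (n ∸ 2 + 2)) % n        ≡⟨ cong (_% n) (+-assoc j (n ∸ 2) 2) ⟨
        (j + (n ∸ 2) + 2) % n        ≡⟨ cong (λ r → (r + 2) % n) (row₁-small (j + (n ∸ 2)) j+d<n) ⟨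
        row₂ (j + (n ∸ 2))           ≡⟨ cong row₂ toℕ-c₂ ⟨
        row₂ (toℕ c₂)                ∎)
        where open ≡-Reasoning
      c₂≡c₁+d : toℕ c₂ ≡ toℕ c₁ + (n ∸ 2)
      c₂≡c₁+d = trans toℕ-c₂ (cong (_+ (n ∸ 2)) (sym toℕ-c₁))
      gap : CoveringGap m (n ∸ 2)
      gap = inj₁ (∸-monoˡ-≤ 1 3≤n′ , ≤-trans (≤-reflexive (m+[n∸m]≡n 2≤n)) n≤m)

  module _ (n′≡2 : n′ ≡ 2) where

    %n≡%3 : ∀ x → x % n ≡ x % 3
    %n≡%3 x = cong (λ k → x % suc k) n′≡2

    row₁-1 : row₁ 1 ≡ 1
    row₁-1 = row₁-small 1 (s≤s (≤-trans (s≤s z≤n) 2≤n′))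

    row₁-3 : row₁ 3 ≡ 1
    row₁-3 = trans (row₁-large 3 λ 3<n → <⇒≢ 3<n (cong suc (sym n′≡2))) (%n≡%3 4)

    row₂-of-row₁≡1 : ∀ i → row₁ i ≡ 1 → row₂ i ≡ 0
    row₂-of-row₁≡1 _ eq = trans (cong (λ r → (r + 2) % n) eq) (%n≡%3 3)

    row₂-suc : ∀ j → j < 2 → row₂ (suc j) ≡ j
    row₂-suc zero          _ = row₂-of-row₁≡1 1 row₁-1
    row₂-suc (suc zero)    _ = trans (cong (λ r → (r + 2) % n) (row₁-small 2 (s≤s 2≤n′))) (%n≡%3 4)
    row₂-suc (suc (suc _)) (s≤s (s≤s ()))

    coveringPairInLowRow-n≡3-4≤m : ∀ b j → toℕ b ≡ j → j < 2 → 3 ≤ m′ → CoveringPairInRow L b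
    coveringPairInLowRow-n≡3-4≤m b j b≡j j<2 3≤m′ =
      (c₁ , c₂ , 2) , (in-row c₁ (trans (cong row₁ (toℕ-fromℕ< 1<m)) row₁-1) j b≡j j<2 ,
                                       in-row c₂ (trans (cong row₁ (toℕ-fromℕ< 3<m)) row₁-3) j b≡j j<2) ,
      trans (toℕ-fromℕ< 3<m) (cong (_+ 2) (sym (toℕ-fromℕ< 1<m))) , gap-2 m (s≤s 2≤m′)
      where
        1<m : 1 < m
        1<m = s≤s (≤-trans (s≤s z≤n) 2≤m′)
        3<m : 3 < m
        3<m = s≤s 3≤m′
        c₁ c₂ : Fin m
        c₁ = fromℕ< 1<m
        c₂ = fromℕ< 3<m
        in-row : ∀ c → row₁ (toℕ c) ≡ 1 → ∀ j → toℕ b ≡ j → j < 2 → (c , b) ∈ L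
        in-row c row₁≡1 zero       b≡0 _ = ∈L₂ c b (trans b≡0 (sym (row₂-of-row₁≡1 (toℕ c) row₁≡1)))
        in-row c row₁≡1 (suc zero) b≡1 _ = ∈L₁ c b (trans b≡1 (sym row₁≡1))
        in-row c _      (suc (suc _)) _ (s≤s (s≤s ()))

    coveringPairInLowRow-n≡3-m≡3 : ∀ b j → toℕ b ≡ j → j < 2 → m′ ≡ 2 → CoveringPairInRow L b
    coveringPairInLowRow-n≡3-m≡3 b j b≡j j<2 m′≡2 =
      (c₁ , c₂ , 1) , (c₁∈L , c₂∈L) ,
      trans (toℕ-fromℕ< 1+j<m) (trans (+-comm 1 j) (cong (_+ 1) (sym (toℕ-fromℕ< j<m)))) ,
      inj₂ ((1 , cong suc m′≡2) , ≤-refl , s≤s (≤-trans (s≤s z≤n) 2≤m′))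
      where
        j<n : j < n
        j<n = subst (_< n) b≡j (toℕ<n b)
        j<m : j < m
        j<m = <-≤-trans j<n n≤m
        1+j<m : suc j < m
        1+j<m = ≤-<-trans j<2 (s≤s 2≤m′)
        c₁ c₂ : Fin m
        c₁ = fromℕ< j<m
        c₂ = fromℕ< 1+j<m
        c₁∈L : (c₁ , b) ∈ L
        c₁∈L = ∈L₁ c₁ b (trans b≡j (sym (trans (cong row₁ (toℕ-fromℕ< j<m)) (row₁-small j j<n))))
        c₂∈L : (c₂ , b) ∈ L
        c₂∈L = ∈L₂ c₂ b (trans b≡j (sym (trans (cong row₂ (toℕ-fromℕ< 1+j<m)) (row₂-suc j j<2))))

  coveringPairInLowRow : ∀ b j → toℕ b ≡ j → j < 2 → CoveringPairInRow L b
  coveringPairInLowRow b j b≡j j<2 with m≤n⇒m<n∨m≡n 2≤n′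
  ... | inj₁ 3≤n′ = coveringPairInLowRow-4≤n b j b≡j j<2 3≤n′
  ... | inj₂ 2≡n′ with m≤n⇒m<n∨m≡n 2≤m′
  ...   | inj₁ 3≤m′ = coveringPairInLowRow-n≡3-4≤m (sym 2≡n′) b j b≡j j<2 3≤m′
  ...   | inj₂ 2≡m′ = coveringPairInLowRow-n≡3-m≡3 (sym 2≡n′) b j b≡j j<2 (sym 2≡m′)

  coveringPairInRow : ∀ b → CoveringPairInRow L b
  coveringPairInRow b with toℕ b in b≡j
  ... | zero        = coveringPairInLowRow b 0 b≡j (s≤s z≤n)
  ... | suc zero    = coveringPairInLowRow b 1 b≡j (s≤s (s≤s z≤n))
  ... | suc (suc j) = coveringPairInHighRow b j b≡j

  monitoringSet : MonitoringSet G L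
  monitoringSet (u₁ , u₂) (v₁ , _) (inj₁ (e , refl)) = coveringPairs⇒monitorsRows coveringPairInRow u₁ v₁ u₂ e
  monitoringSet (u₁ , u₂) (_ , v₂) (inj₂ (refl , e)) with coveringPairInColumn u₁
  ... | (s₁ , s₂ , d) , (s₁∈L , s₂∈L) , s₂≡s₁+d , gap with Tˢ.coveringPair-monitorsRow u₁ s₁ s₂ d s₂≡s₁+d gap u₂ v₂ e
  ...   | inj₁ mon = (u₁ , s₁) , s₁∈L , Monitors-≅ □-comm mon
  ...   | inj₂ mon = (u₁ , s₂) , s₂∈L , Monitors-≅ □-comm mon

  upperBound : Σ (List V) λ L → IsDEM G L × length L ≡ m + m
  upperBound = L , (unique-L , monitoringSet) , length-L

m+m≡2*m : ∀ k → k + k ≡ 2 * k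
m+m≡2*m k = cong (k +_) (sym (+-identityʳ k))

module _ (m′ n′ : ℕ) (2≤m′ : 2 ≤ m′) (2≤n′ : 2 ≤ n′) where
  open Torus m′ n′ 2≤m′ 2≤n′ using (m; n; G)

  dem-lowerBound : ∀ L → IsDEM G L → 2 * m ⊔ 2 * n ≤ length L
  dem-lowerBound L dem = ⊔-lub
    (subst₂ _≤_ (*-comm m 2) (length-map swap L)
            (Torus.rowsLowerBound n′ m′ 2≤n′ 2≤m′ (proj₂ (IsDEM-≅ □-comm dem))))
    (subst (_≤ length L) (*-comm n 2) (Torus.rowsLowerBound m′ n′ 2≤m′ 2≤n′ (proj₂ dem)))

  dem-upperBound : Σ (List (Fin m × Fin n)) λ L → IsDEM G L × length L ≡ 2 * m ⊔ 2 * n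
  dem-upperBound with ≤-total n′ m′
  ... | inj₁ n′≤m′ =
    let L , dem , length-L = UpperBound.upperBound m′ n′ 2≤m′ 2≤n′ n′≤m′
    in L , dem , trans length-L (trans (m+m≡2*m m) (sym (m≥n⇒m⊔n≡m (*-monoʳ-≤ 2 (s≤s n′≤m′)))))
  ... | inj₂ m′≤n′ =
    let L , dem , length-L = UpperBound.upperBound n′ m′ 2≤n′ 2≤m′ m′≤n′
    in map swap L , IsDEM-≅ □-comm dem ,
       trans (length-map swap L)
             (trans length-L (trans (m+m≡2*m n) (sym (m≤n⇒m⊔n≡n (*-monoʳ-≤ 2 (s≤s m′≤n′))))))

mainTheorem15 : (m n : ℕ) → 3 ≤ m → 3 ≤ n →
    DemIs (BoxAdj (CycleAdj m) (CycleAdj n)) ((2 * m) ⊔ (2 * n))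
mainTheorem15 (suc m′) (suc n′) (s≤s 2≤m′) (s≤s 2≤n′) =
  dem-upperBound m′ n′ 2≤m′ 2≤n′ , dem-lowerBound m′ n′ 2≤m′ 2≤n′
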